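{- Let $F$ be a set, $\mathcal D$ an ultrafilter on $F$, and $\psi$ a formula of $L(\Sigma_2^g)$ that is infrafiltrated with respect to $\mathcal D$. Then $\lnot\psi$ is infrafiltrated with respect to $\mathcal D$.
   Context: Types: $0$ is the first-order type; for $k\ge0$, $[\tau_0,\ldots,\tau_k]$ with all $\tau_\mu=0$ is a second-order type; for a set $A$, $0(A)=A$, $\check\tau(A)=A^{k+1}$, $\tau(A)=\mathcal P(A^{k+1})$. A generalized second-order signature $\Sigma_2^g$ has a set $\Theta$ of such types (containing $0$ and some second-order type), $\Theta_b$ its second-order types, constant symbols $\sigma^\tau_\omega$, binary predicate symbols $\delta_\tau$ ($\tau\in\Theta$), $\varepsilon_\tau$ ($\tau\in\Theta_b$), and variables of each type; formulas of $L(\Sigma_2^g)$ are built from atomic formulas $q\,\delta_\tau\,r$, $(q_0,\ldots,q_k)\,\varepsilon_\tau\,r$ with $\lnot,\land,\lor,\Rightarrow,\exists,\forall$. A system $U=\langle A,S\rangle$: set $A$, constants $s^\tau_\omega\in\tau(A)$, $\approx_\tau\subseteq\tau(A)^2$ containing identity, $\tilde\in_\tau\subseteq\check\tau(A)\times\tau(A)$ containing membership; satisfaction $U\vDash\varphi[\gamma]$ interprets $\delta_\tau$ by $\approx_\tau$, $\varepsilon_\tau$ by $\tilde\in_\tau$, connectives as usual, quantifiers over all of $\tau(A)$. $U$ has true generalized equalities and belongings if each $\approx_\tau$ is an equivalence relation and $x_\mu\approx y_\mu$, $u\approx_\tau v$ imply $((x_\mu)\mathrel{\tilde\in_\tau}u\Leftrightarrow(y_\mu)\mathrel{\tilde\in_\tau}v)$.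 Infra-$\mathcal D$-product $\mathrm{Inf}_{\mathcal D}\prod_fU_f$ of $U_f=\langle A_f,S_f\rangle$: support $A=\prod_fA_f$; $p(f)(\mu)=p(\mu)(f)$; $P\langle f\rangle=\{p(f):p\in P\}$; constants $s^0_\omega(f)=s^0_{\omega f}$, $s^\tau_\omega=\{p:\forall f\ p(f)\in s^\tau_{\omega f}\}$; $p\approx_0q$ iff $\exists G\in\mathcal D\,\forall g\in G\ p(g)\approx_{0,g}q(g)$; $P\approx_\tau Q$ iff $\exists G\in\mathcal D\,\forall g\in G\ P\langle g\rangle\approx_{\tau,g}Q\langle g\rangle$; $p\mathrel{\tilde\in_\tau}P$ iff $\exists G\in\mathcal D\,\forall g\in G\ p(g)\mathrel{\tilde\in_{\tau,g}}P\langle g\rangle$. Crossing $\bowtie_f\gamma_f$: $\gamma(x)(f)=\gamma_f(x)$ for type $0$, $\gamma(x)=\{p:\forall f\ p(f)\in\gamma_f(x)\}$ otherwise. $\varphi$ is infrafiltrated with respect to $\mathcal D$ if for every collection $(\langle U_f,\gamma_f\rangle)_{f\in F}$ of evaluated systems with true generalized equalities and belongings: $\mathrm{Inf}_{\mathcal D}\prod_fU_f\vDash\varphi[\bowtie_f\gamma_f]$ iff $\{g\in F:U_g\vDash\varphi[\gamma_g]\}\in\mathcal D$. An ultrafilter is a maximal proper filter (equivalently a filter such that for every $G\subseteq F$ exactly one of $G$, $F\setminus G$ belongs to it). -}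

module Defs where

open import Level using (Level; _⊔_; Lift; lift; lower) renaming (suc to lsuc; zero to lzero)
open import Data.Nat using (ℕ; _≡ᵇ_)
import Data.Nat as ℕ
open import Data.Fin using (Fin)
open import Data.Bool using (if_then_else_)
open import Data.Product using (Σ; _×_; _,_)
open import Data.Sum using (_⊎_)
open import Data.Unit.Polymorphic using (⊤)
open import Data.Empty.Polymorphic using (⊥)
open import Relation.Nullary using (¬_; yes; no)
open import Relation.Unary using (Pred; _⊆_; _∩_; ∁)
open import Relation.Binary.PropositionalEquality using (_≡_; refl)
open import Function.Bundles using (_⇔_)

data Ty : Set where
  base : Ty
  sec  : ℕ → Ty      -- sec k = [τ_0,…,τ_k] with all τ_μ = 0

Tuple : ℕ → Set → Set
Tuple k A = Fin (ℕ.suc k) → A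

-- τ(A): 0(A) = A,  τ(A) = P(A^{k+1})  (subsets as predicates)
⟦_⟧ : Ty → Set → Set₁
⟦ base ⟧  A = Lift (lsuc lzero) A
⟦ sec k ⟧ A = Pred (Tuple k A) lzero

record Signature : Set₁ where
  field
    Θ      : Ty → Set
    hasBase : Θ base
    hasSec  : Σ ℕ (λ k → Θ (sec k))
    Const  : Ty → Set

module _ (S : Signature) where
  open Signature S

  data Term (τ : Ty) : Set where
    var : Θ τ → ℕ → Term τ
    con : Θ τ → Const τ → Term τ

  data Fm : Set where
    δ    : {τ : Ty} → Θ τ → Term τ → Term τ → Fm
    ε    : {k : ℕ} → Θ (sec k) → (Fin (ℕ.suc k) → Term base) → Term (sec k) → Fm
    ¬ᶠ_  : Fm → Fm
    _∧ᶠ_ : Fm → Fm → Fm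
    _∨ᶠ_ : Fm → Fm → Fm
    _⇒ᶠ_ : Fm → Fm → Fm
    ∃ᶠ   : (τ : Ty) → Θ τ → ℕ → Fm → Fm
    ∀ᶠ   : (τ : Ty) → Θ τ → ℕ → Fm → Fm

  record SysData (r : Level) : Set (lsuc (lsuc lzero) ⊔ lsuc r) where
    field
      A     : Set
      const : (τ : Ty) → Θ τ → Const τ → ⟦ τ ⟧ A
      eq    : (τ : Ty) → Θ τ → ⟦ τ ⟧ A → ⟦ τ ⟧ A → Set r
      mem   : (k : ℕ) → Θ (sec k) → Tuple k A → ⟦ sec k ⟧ A → Set r

  record IsSystem {r : Level} (U : SysData r) : Set (lsuc lzero ⊔ r) where
    open SysData U
    field
      eq-refl : (τ : Ty) (θ : Θ τ) (x : ⟦ τ ⟧ A) → eq τ θ x x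
      mem-⊇   : (k : ℕ) (θ : Θ (sec k)) (x : Tuple k A) (P : ⟦ sec k ⟧ A) →
                P x → mem k θ x P

  record TrueEqBel {r : Level} (U : SysData r) : Set (lsuc lzero ⊔ r) where
    open SysData U
    field
      refl′  : (τ : Ty) (θ : Θ τ) (x : ⟦ τ ⟧ A) → eq τ θ x x
      sym′   : (τ : Ty) (θ : Θ τ) (x y : ⟦ τ ⟧ A) → eq τ θ x y → eq τ θ y x
      trans′ : (τ : Ty) (θ : Θ τ) (x y z : ⟦ τ ⟧ A) →
               eq τ θ x y → eq τ θ y z → eq τ θ x z
      cong′  : (k : ℕ) (θ : Θ (sec k)) (x y : Tuple k A) (u v : ⟦ sec k ⟧ A) →
               ((μ : Fin (ℕ.suc k)) → eq base hasBase (lift (x μ)) (lift (y μ))) →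
               eq (sec k) θ u v → (mem k θ x u ⇔ mem k θ y v)

  Env : Set → Set₁
  Env A = (τ : Ty) → ℕ → ⟦ τ ⟧ A

  update : {A : Set} → Env A → (τ : Ty) → ℕ → ⟦ τ ⟧ A → Env A
  update γ base    n v base    m = if n ≡ᵇ m then v else γ base m
  update γ base    n v (sec j) m = γ (sec j) m
  update γ (sec k) n v base    m = γ base m
  update γ (sec k) n v (sec j) m with k ℕ.≟ j
  ... | yes refl = if n ≡ᵇ m then v else γ (sec j) m
  ... | no _     = γ (sec j) m

  module _ {r : Level} (U : SysData r) where
    open SysData U

    evalT : {τ : Ty} → Env A → Term τ → ⟦ τ ⟧ A
    evalT {τ} γ (var θ n) = γ τ n
    evalT {τ} γ (con θ c) = const τ θ c

    Sat : Fm → Env A → Set (lsuc lzero ⊔ r)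
    Sat (δ {τ} θ q t)   γ = Lift (lsuc lzero) (eq τ θ (evalT γ q) (evalT γ t))
    Sat (ε {k} θ qs t)  γ = Lift (lsuc lzero)
                              (mem k θ (λ μ → lower (evalT γ (qs μ))) (evalT γ t))
    Sat (¬ᶠ φ)          γ = ¬ Sat φ γ
    Sat (φ ∧ᶠ χ)        γ = Sat φ γ × Sat χ γ
    Sat (φ ∨ᶠ χ)        γ = Sat φ γ ⊎ Sat χ γ
    Sat (φ ⇒ᶠ χ)        γ = Sat φ γ → Sat χ γ
    Sat (∃ᶠ τ θ n φ)    γ = Σ (⟦ τ ⟧ A) (λ v → Sat φ (update γ τ n v))
    Sat (∀ᶠ τ θ n φ)    γ = (v : ⟦ τ ⟧ A) → Sat φ (update γ τ n v)

  module _ {r d : Level} {F : Set} (D : Pred (Pred F (lsuc lzero ⊔ r)) d)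
           (U : F → SysData r) where
    private
      Af : F → Set
      Af f = SysData.A (U f)
      Π : Set
      Π = (f : F) → Af f

    at : {k : ℕ} → Tuple k Π → (f : F) → Tuple k (Af f)
    at p f μ = p μ f

    proj : {k : ℕ} → ⟦ sec k ⟧ Π → (f : F) → ⟦ sec k ⟧ (Af f)
    proj {k} P f a = Σ (Tuple k Π) (λ p → P p × ((μ : Fin (ℕ.suc k)) → p μ f ≡ a μ))

    Eventually : ∀ {ℓ} → (F → Set ℓ) → Set (lsuc (lsuc lzero ⊔ r) ⊔ d ⊔ ℓ)
    Eventually R = Σ (Pred F (lsuc lzero ⊔ r)) (λ G → D G × ((g : F) → G g → R g))

    InfProd : SysData (lsuc (lsuc lzero ⊔ r) ⊔ d)
    InfProd = record
      { A     = Π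
      ; const = λ { base θ c → lift (λ f → lower (SysData.const (U f) base θ c))
                  ; (sec k) θ c → λ p → (f : F) → SysData.const (U f) (sec k) θ c (at p f) }
      ; eq    = λ { base θ p q → Eventually (λ g →
                        SysData.eq (U g) base θ (lift (lower p g)) (lift (lower q g)))
                  ; (sec k) θ P Q → Eventually (λ g →
                        SysData.eq (U g) (sec k) θ (proj P g) (proj Q g)) }
      ; mem   = λ k θ p P → Eventually (λ g → SysData.mem (U g) k θ (at p g) (proj P g))
      }

    cross : ((f : F) → Env (Af f)) → Env Π
    cross γs base    n = lift (λ f → lower (γs f base n))
    cross γs (sec k) n = λ p → (f : F) → γs f (sec k) n (at p f)

  Infrafiltrated : {r d : Level} {F : Set} (D : Pred (Pred F (lsuc lzero ⊔ r)) d) →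
                   Fm → Set _
  Infrafiltrated {r} {d} {F} D φ =
    (U : F → SysData r) →
    ((f : F) → IsSystem (U f)) →
    ((f : F) → TrueEqBel (U f)) →
    (γs : (f : F) → Env (SysData.A (U f))) →
    Sat (InfProd D U) φ (cross D U γs) ⇔ D (λ g → Sat (U g) φ (γs g))

record IsFilter {ℓ d : Level} {F : Set} (D : Pred (Pred F ℓ) d) : Set (lsuc ℓ ⊔ d) where
  field
    whole  : D (λ _ → ⊤)
    proper : ¬ D (λ _ → ⊥)
    upward : {G H : Pred F ℓ} → G ⊆ H → D G → D H
    inter  : {G H : Pred F ℓ} → D G → D H → D (G ∩ H)

record IsUltrafilter {ℓ d : Level} {F : Set} (D : Pred (Pred F ℓ) d) : Set (lsuc ℓ ⊔ d) where
  field
    isFilter : IsFilter D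
    dichotomy : (G : Pred F ℓ) → D G ⊎ D (∁ G)

module Submission where

-- First, a purely
-- filter-theoretic fact: for an ultrafilter D, the complement of G belongs
-- to D exactly when G does not (dichotomy gives one direction, properness
-- together with closure under intersections and supersets the other).
-- The theorem then chains these:  Inf ⊨ ¬ψ  is  ¬ (Inf ⊨ ψ),  which by the
-- infrafiltration of ψ is  ¬ (G ∈ D)  for  G = {g : U_g ⊨ ψ},  which by the
-- ultrafilter lemma is  ∁G ∈ D,  i.e. the set where  U_g ⊨ ¬ψ  is in D.

open import Defs
open import Level using (Level; _⊔_; lift) renaming (suc to lsuc; zero to lzero)
open import Relation.Unary using (Pred; ∁)
open import Relation.Nullary using (¬_)
open import Data.Empty using (⊥-elim)
open import Data.Sum using (inj₁; inj₂)
open import Data.Product using (_,_)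
open import Function.Bundles using (_⇔_; mk⇔; Equivalence)
open import Function.Properties.Equivalence using () renaming (trans to ⇔-trans)

¬-cong-⇔ : ∀ {a b} {P : Set a} {Q : Set b} → P ⇔ Q → (¬ P) ⇔ (¬ Q)
¬-cong-⇔ P⇔Q = mk⇔ (λ ¬p q → ¬p (Equivalence.from P⇔Q q))
                    (λ ¬q p → ¬q (Equivalence.to P⇔Q p))

ultrafilter-¬⇔∁ : ∀ {ℓ d} {F : Set} {D : Pred (Pred F ℓ) d} →
                  IsUltrafilter D → (G : Pred F ℓ) → (¬ D G) ⇔ D (∁ G)
ultrafilter-¬⇔∁ {D = D} uf G = mk⇔ complement-large not-both
  where
    open IsUltrafilter uf
    open IsFilter isFilter

    complement-large : ¬ D G → D (∁ G)
    complement-large ¬DG with dichotomy G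
    ... | inj₁ DG  = ⊥-elim (¬DG DG)
    ... | inj₂ D∁G = D∁G

    -- G ∩ ∁G is empty, so both being large would contradict properness
    not-both : D (∁ G) → ¬ D G
    not-both D∁G DG =
      proper (upward (λ { (g∈G , g∉G) → lift (g∉G g∈G) }) (inter DG D∁G))

lemma7 : {r d : Level} (S : Signature) (F : Set)
         (D : Pred (Pred F (lsuc lzero ⊔ r)) d) →
         IsUltrafilter D →
         (ψ : Fm S) →
         Infrafiltrated S {r} D ψ →
         Infrafiltrated S {r} D (¬ᶠ ψ)
lemma7 S F D ultra ψ ψ-infra U isSys trueEqBel γs =
  ⇔-trans (¬-cong-⇔ (ψ-infra U isSys trueEqBel γs))
          (ultrafilter-¬⇔∁ ultra (λ g → Sat S (U g) ψ (γs g)))
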